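{- Every positive integer is a sum of at most $6$ squares not divisible by $3$, and in fact $S(3)=6$.
   Context: For a prime $p$, an integer $n$ is a sum of $k$ squares not divisible by $p$ if there are integers $x_1,\dots,x_k$ with $n=x_1^2+\cdots+x_k^2$ and $\gcd(p,x_1x_2\cdots x_k)=1$. $S(p)$ denotes the smallest integer $k$ such that every positive integer is a sum of at most $k$ squares not divisible by $p$. -}

module Defs where

open import Data.Nat using (ℕ; zero; suc; _≤_; _<_)
open import Data.Fin using (Fin; zero; suc)
open import Data.Integer using (ℤ; _+_; _*_; +_; 0ℤ; 1ℤ)
open import Data.Integer.GCD using (gcd)
open import Data.Nat.Primality using (Prime)
open import Data.Product using (Σ; ∃; _×_; _,_)
open import Relation.Binary.PropositionalEquality using (_≡_)
open import Relation.Nullary using (¬_)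

sumℤ : ∀ {k : ℕ} → (Fin k → ℤ) → ℤ
sumℤ {zero}  f = 0ℤ
sumℤ {suc k} f = f zero + sumℤ (λ i → f (suc i))

prodℤ : ∀ {k : ℕ} → (Fin k → ℤ) → ℤ
prodℤ {zero}  f = 1ℤ
prodℤ {suc k} f = f zero * prodℤ (λ i → f (suc i))

SumOfSquaresNotDiv : (p : ℕ) (k : ℕ) (n : ℕ) → Set
SumOfSquaresNotDiv p k n =
  Σ (Fin k → ℤ) λ x →
    (+ n ≡ sumℤ (λ i → x i * x i)) × (gcd (+ p) (prodℤ x) ≡ 1ℤ)

SumOfAtMost : (p : ℕ) (k : ℕ) (n : ℕ) → Set
SumOfAtMost p k n = Σ ℕ λ m → (m ≤ k) × SumOfSquaresNotDiv p m n

AllPositiveSumOfAtMost : (p : ℕ) (k : ℕ) → Set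
AllPositiveSumOfAtMost p k = ∀ (n : ℕ) → 0 < n → SumOfAtMost p k n

IsS : (p : ℕ) (k : ℕ) → Set
IsS p k = AllPositiveSumOfAtMost p k × (∀ (j : ℕ) → j < k → ¬ AllPositiveSumOfAtMost p j)

-- Squares of integers prime to 3 are ≡ 1 (mod 3). By Lagrange's theorem, n ≡ 1 (mod 3) is a sum
-- of four squares, and the number of them prime to 3 is ≡ n, so it is 1 or 4. If it is 1, then
-- n = a² + 9(b² + c² + d²), and 9(b² + c² + d²) with (b, c, d) ≠ 0 is a sum of three squares prime
-- to 3: after removing common factors 3 and choosing signs so that s = b + c + d is prime to 3,
-- the map v ↦ 3v − 2s(1, 1, 1) multiplies the norm by 9 and makes every coordinate ≡ s (mod 3).
-- Adding at most two squares 1² reaches the other residues, so 6 squares suffice. They are needed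
-- for 15: squares prime to 3 are 1, 4 or at least 16, and 15 is not k + 3e with e ≤ k ≤ 5.

module Submission where

open import Defs
open import Data.Empty using (⊥)
open import Data.Fin.Base using (Fin; zero; suc; toℕ; fromℕ<; splitAt; join)
import Data.Fin.Properties as Fin
open import Data.Integer.Base using (ℤ; +_; -_; _+_; _-_; _*_; ∣_∣; 0ℤ; 1ℤ; -1ℤ; -[1+_])
open import Data.Integer.DivMod using (_%ℕ_; _/ℕ_; n%ℕd<d; a≡a%ℕn+[a/ℕn]*n)
open import Data.Integer.Divisibility.Signed using (divides; ∣ᵤ⇒∣)
open import Data.Integer.GCD using (gcd)
import Data.Integer.Properties as ℤ
open import Data.Integer.Tactic.RingSolver using (solve-∀)
open import Data.Nat.Base as ℕ using (ℕ; zero; suc; NonZero; _∸_; _≤_; _<_; z≤n; s≤s; nonTrivial⇒n>1)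
open import Data.Nat.DivMod using (m%n<n; m≡m%n+[m/n]*n)
open import Data.Nat.Divisibility
  using (_∣_; divides; _∣0; ∣⇒≤; ∣-trans; ∣-refl; m∣m*n; n∣m*n; ∣1⇒≡1; quotient; quotient≢0; m∣n⇒n≡quotient*m)
import Data.Nat.GCD as ℕ
open import Data.Nat.Induction using (<-rec)
open import Data.Nat.Primality
  using ( Prime; euclidsLemma; prime⇒irreducible; prime⇒nonZero; prime?; ¬prime[1]
        ; composite?; composite; ¬composite⇒prime)
import Data.Nat.Properties as ℕ
import Data.Nat.Tactic.RingSolver as ℕ-Solver
open import Data.Product.Base using (Σ; ∃-syntax; ∃₂; _×_; _,_; proj₁; proj₂)
open import Data.Sum.Base using (_⊎_; inj₁; inj₂)
open import Data.Vec.Functional using (Vector; []; _∷_)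
open import Function.Base using (_∘_)
open import Relation.Binary.Definitions using (tri<; tri≈; tri>)
open import Relation.Binary.PropositionalEquality
open import Relation.Nullary.Decidable.Core using (yes; no; Dec; from-yes; ¬?; _→-dec_)
open import Relation.Nullary.Negation.Core using (¬_; contradiction)

infix 4 _≡_[mod_]
record _≡_[mod_] (x y : ℤ) (m : ℕ) : Set where
  constructor congruent
  field
    quotient : ℤ
    equation : x ≡ y + + m * quotient

≡[mod]-sym : ∀ {x y m} → x ≡ y [mod m ] → y ≡ x [mod m ]
≡[mod]-sym {m = m} (congruent q refl) = congruent (- q) (flip _ (+ m) q)
  where
  flip : ∀ y M q → y ≡ y + M * q + M * (- q)
  flip = solve-∀

≡[mod]-trans : ∀ {x y z m} → x ≡ y [mod m ] → y ≡ z [mod m ] → x ≡ z [mod m ]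
≡[mod]-trans {z = z} {m = m} (congruent q refl) (congruent q′ refl) =
  congruent (q′ + q) (regroup z (+ m) q q′)
  where
  regroup : ∀ z M q q′ → z + M * q′ + M * q ≡ z + M * (q′ + q)
  regroup = solve-∀

≡[mod]-+ : ∀ {x y x′ y′ m} → x ≡ y [mod m ] → x′ ≡ y′ [mod m ] → x + x′ ≡ y + y′ [mod m ]
≡[mod]-+ {y = y} {y′ = y′} {m} (congruent q refl) (congruent q′ refl) =
  congruent (q + q′) (regroup y y′ (+ m) q q′)
  where
  regroup : ∀ y y′ M q q′ → y + M * q + (y′ + M * q′) ≡ y + y′ + M * (q + q′)
  regroup = solve-∀

≡[mod]-neg : ∀ {x y m} → x ≡ y [mod m ] → - x ≡ - y [mod m ]
≡[mod]-neg {y = y} {m} (congruent q refl) = congruent (- q) (negate y (+ m) q)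
  where
  negate : ∀ y M q → - (y + M * q) ≡ - y + M * - q
  negate = solve-∀

%ℕ-≡⇒≡[mod] : ∀ {m} .{{_ : NonZero m}} x y → x %ℕ m ≡ y %ℕ m → x ≡ y [mod m ]
%ℕ-≡⇒≡[mod] {m} x y eq = congruent (x /ℕ m - y /ℕ m) (begin
  x                              ≡⟨ a≡a%ℕn+[a/ℕn]*n x m ⟩
  + (x %ℕ m) + x /ℕ m * + m      ≡⟨ cong (λ r → + r + x /ℕ m * + m) eq ⟩
  + (y %ℕ m) + x /ℕ m * + m      ≡⟨ shift (+ (y %ℕ m)) (x /ℕ m) (y /ℕ m) (+ m) ⟩
  + (y %ℕ m) + y /ℕ m * + m + D  ≡⟨ cong (_+ D) (a≡a%ℕn+[a/ℕn]*n y m) ⟨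
  y + D                          ∎)
  where
  open ≡-Reasoning
  D = + m * (x /ℕ m - y /ℕ m)
  shift : ∀ r a b M → r + a * M ≡ r + b * M + M * (a - b)
  shift = solve-∀

∣∧<⇒≡0 : ∀ {m n} → m ∣ n → n < m → n ≡ 0
∣∧<⇒≡0 {n = zero}  _   _   = refl
∣∧<⇒≡0 {n = suc _} m∣n n<m = contradiction (∣⇒≤ m∣n) (ℕ.<⇒≱ n<m)

+≡+[mod]⇒∣∸ : ∀ {m a b} → + a ≡ + b [mod m ] → m ∣ a ∸ b
+≡+[mod]⇒∣∸ {m} {a} {b} (congruent (+ k) eq) = divides k (begin
  a ∸ b               ≡⟨ cong (_∸ b) (ℤ.+-injective (trans eq (cong (_+_ (+ b)) (sym (ℤ.pos-* m k))))) ⟩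
  b ℕ.+ m ℕ.* k ∸ b   ≡⟨ ℕ.m+n∸m≡n b (m ℕ.* k) ⟩
  m ℕ.* k             ≡⟨ ℕ.*-comm m k ⟩
  k ℕ.* m             ∎)
  where open ≡-Reasoning
+≡+[mod]⇒∣∸ {m} {a} {b} (congruent -[1+ k ] eq) = subst (m ∣_) (sym (ℕ.m≤n⇒m∸n≡0 a≤b)) (m ∣0)
  where
  open ≡-Reasoning
  cancel : ∀ B M K → B + M * - K + M * K ≡ B
  cancel = solve-∀
  a≤b : a ≤ b
  a≤b = subst (a ≤_) (ℤ.+-injective (begin
    + (a ℕ.+ m ℕ.* suc k)                 ≡⟨ ℤ.pos-+ a (m ℕ.* suc k) ⟩
    + a + + (m ℕ.* suc k)                 ≡⟨ cong₂ _+_ eq (ℤ.pos-* m (suc k)) ⟩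
    + b + + m * - + suc k + + m * + suc k ≡⟨ cancel (+ b) (+ m) (+ suc k) ⟩
    + b                                   ∎)) (ℕ.m≤m+n a (m ℕ.* suc k))

≡[mod]⇒≡ : ∀ {m a b} → a < m → b < m → + a ≡ + b [mod m ] → a ≡ b
≡[mod]⇒≡ {m} a<m b<m a≡b = ℕ.≤-antisym (≤-if-≡[mod] a<m a≡b) (≤-if-≡[mod] b<m (≡[mod]-sym a≡b))
  where
  ≤-if-≡[mod] : ∀ {x y} → x < m → + x ≡ + y [mod m ] → x ≤ y
  ≤-if-≡[mod] {x} {y} x<m x≡y = ℕ.m∸n≡0⇒m≤n (∣∧<⇒≡0 (+≡+[mod]⇒∣∸ x≡y) (ℕ.≤-<-trans (ℕ.m∸n≤m x y) x<m))

∣∣x∣⇒x≡0[mod] : ∀ {m x} → m ∣ ∣ x ∣ → x ≡ 0ℤ [mod m ]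
∣∣x∣⇒x≡0[mod] {m} {x} m∣∣x∣ with ∣ᵤ⇒∣ {+ m} {x} m∣∣x∣
... | divides q x≡qm = congruent q (trans x≡qm (trans (ℤ.*-comm q (+ m)) (sym (ℤ.+-identityˡ _))))

sumSq₄ : ℤ → ℤ → ℤ → ℤ → ℤ
sumSq₄ a b c d = a * a + b * b + c * c + d * d

IsSumSq₄ : ℤ → Set
IsSumSq₄ n = ∃[ a ] ∃[ b ] ∃[ c ] ∃[ d ] n ≡ sumSq₄ a b c d

euler-four-square : ∀ a b c d e f g h →
  (a * a + b * b + c * c + d * d) * (e * e + f * f + g * g + h * h) ≡
  (a * e + b * f + c * g + d * h) * (a * e + b * f + c * g + d * h) +
  (a * f - b * e + c * h - d * g) * (a * f - b * e + c * h - d * g) +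
  (a * g - b * h - c * e + d * f) * (a * g - b * h - c * e + d * f) +
  (a * h + b * g - c * f - d * e) * (a * h + b * g - c * f - d * e)
euler-four-square = solve-∀

IsSumSq₄-* : ∀ {x y} → IsSumSq₄ x → IsSumSq₄ y → IsSumSq₄ (x * y)
IsSumSq₄-* (a , b , c , d , refl) (e , f , g , h , refl) =
  a * e + b * f + c * g + d * h , a * f - b * e + c * h - d * g ,
  a * g - b * h - c * e + d * f , a * h + b * g - c * f - d * e ,
  euler-four-square a b c d e f g h

square-abs : ∀ i → i * i ≡ + (∣ i ∣ ℕ.* ∣ i ∣)
square-abs (+ n)    = sym (ℤ.pos-* n n)
square-abs -[1+ n ] = refl

sumSq₄-abs : ∀ a b c d →
  sumSq₄ a b c d ≡ + (∣ a ∣ ℕ.* ∣ a ∣ ℕ.+ ∣ b ∣ ℕ.* ∣ b ∣ ℕ.+ ∣ c ∣ ℕ.* ∣ c ∣ ℕ.+ ∣ d ∣ ℕ.* ∣ d ∣)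
sumSq₄-abs a b c d = begin
  a * a + b * b + c * c + d * d
    ≡⟨ cong₂ _+_ (cong₂ _+_ (cong₂ _+_ (square-abs a) (square-abs b)) (square-abs c)) (square-abs d) ⟩
  + A + + B + + C + + D
    ≡⟨ cong (_+ + D) (cong (_+ + C) (ℤ.pos-+ A B)) ⟨
  + (A ℕ.+ B) + + C + + D
    ≡⟨ cong (_+ + D) (ℤ.pos-+ (A ℕ.+ B) C) ⟨
  + (A ℕ.+ B ℕ.+ C) + + D
    ≡⟨ ℤ.pos-+ (A ℕ.+ B ℕ.+ C) D ⟨
  + (A ℕ.+ B ℕ.+ C ℕ.+ D) ∎
  where
  open ≡-Reasoning
  A = ∣ a ∣ ℕ.* ∣ a ∣
  B = ∣ b ∣ ℕ.* ∣ b ∣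
  C = ∣ c ∣ ℕ.* ∣ c ∣
  D = ∣ d ∣ ℕ.* ∣ d ∣

pigeonhole-⊎ : ∀ {a b m} → m < a ℕ.+ b → (f : Fin a ⊎ Fin b → Fin m) → ∃₂ λ s t → s ≢ t × f s ≡ f t
pigeonhole-⊎ {a} {b} m<a+b f with i , j , i<j , fi≡fj ← Fin.pigeonhole m<a+b (f ∘ splitAt a) =
  splitAt a i , splitAt a j , (λ eq → Fin.<-irrefl (splitAt-injective eq) i<j) , fi≡fj
  where
  splitAt-injective : splitAt a i ≡ splitAt a j → i ≡ j
  splitAt-injective eq =
    trans (sym (Fin.join-splitAt a b i)) (trans (cong (join a b) eq) (Fin.join-splitAt a b j))

square-∸ : ∀ {u v} → u ≤ v → v ℕ.* v ∸ u ℕ.* u ≡ (v ∸ u) ℕ.* (v ℕ.+ u)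
square-∸ {u} {v} u≤v = begin
  v ℕ.* v ∸ u ℕ.* u                             ≡⟨ cong (λ w → w ℕ.* w ∸ u ℕ.* u) v≡u+d ⟩
  (u ℕ.+ d) ℕ.* (u ℕ.+ d) ∸ u ℕ.* u             ≡⟨ cong (_∸ u ℕ.* u) (expand u d) ⟩
  u ℕ.* u ℕ.+ d ℕ.* (u ℕ.+ d ℕ.+ u) ∸ u ℕ.* u  ≡⟨ ℕ.m+n∸m≡n (u ℕ.* u) _ ⟩
  d ℕ.* (u ℕ.+ d ℕ.+ u)                         ≡⟨ cong (λ w → d ℕ.* (w ℕ.+ u)) v≡u+d ⟨
  d ℕ.* (v ℕ.+ u)                               ∎
  where
  open ≡-Reasoning
  d = v ∸ u
  v≡u+d = sym (ℕ.m+[n∸m]≡n u≤v)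
  expand : ∀ u d → (u ℕ.+ d) ℕ.* (u ℕ.+ d) ≡ u ℕ.* u ℕ.+ d ℕ.* (u ℕ.+ d ℕ.+ u)
  expand = ℕ-Solver.solve-∀

squares-incongruent : ∀ {p u v} → Prime p → u < v → v ℕ.+ u < p → ¬ (+ v * + v ≡ + u * + u [mod p ])
squares-incongruent {p} {u} {v} p-prime u<v v+u<p (congruent q eq)
  with euclidsLemma (v ∸ u) (v ℕ.+ u) p-prime p∣[v-u][v+u]
  where
  p∣[v-u][v+u] : p ∣ (v ∸ u) ℕ.* (v ℕ.+ u)
  p∣[v-u][v+u] = subst (p ∣_) (square-∸ (ℕ.<⇒≤ u<v))
    (+≡+[mod]⇒∣∸ (congruent q (subst₂ (λ a b → a ≡ b + + p * q) (sym (ℤ.pos-* v v)) (sym (ℤ.pos-* u u)) eq)))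
... | inj₁ p∣v-u = ℕ.>⇒≢ (ℕ.m<n⇒0<n∸m u<v)
                     (∣∧<⇒≡0 p∣v-u (ℕ.≤-<-trans (ℕ.m∸n≤m v u) (ℕ.≤-<-trans (ℕ.m≤m+n v u) v+u<p)))
... | inj₂ p∣v+u = ℕ.>⇒≢ (ℕ.<-≤-trans (ℕ.≤-<-trans z≤n u<v) (ℕ.m≤m+n v u)) (∣∧<⇒≡0 p∣v+u v+u<p)

squares-injective-mod : ∀ {p u v} → Prime p → u ℕ.+ v < p → + u * + u ≡ + v * + v [mod p ] → u ≡ v
squares-injective-mod {p} {u} {v} p-prime u+v<p u²≡v² with ℕ.<-cmp u v
... | tri< u<v _ _ = contradiction (≡[mod]-sym {m = p} u²≡v²)
                       (squares-incongruent p-prime u<v (subst (_< p) (ℕ.+-comm u v) u+v<p))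
... | tri≈ _ u≡v _ = u≡v
... | tri> _ _ v<u = contradiction u²≡v² (squares-incongruent p-prime v<u u+v<p)

neg-suc-cancel-≡[mod] : ∀ {m} a b → - (1ℤ + a) ≡ - (1ℤ + b) [mod m ] → a ≡ b [mod m ]
neg-suc-cancel-≡[mod] {m} a b (congruent q eq) = congruent (- q) (begin
  a                              ≡⟨ flip a ⟩
  - (- (1ℤ + a)) - 1ℤ            ≡⟨ cong (λ z → - z - 1ℤ) eq ⟩
  - (- (1ℤ + b) + + m * q) - 1ℤ  ≡⟨ rearrange b (+ m) q ⟩
  b + + m * - q                  ∎)
  where
  open ≡-Reasoning
  flip : ∀ a → a ≡ - (- (1ℤ + a)) - 1ℤ
  flip = solve-∀
  rearrange : ∀ b M q → - (- (1ℤ + b) + M * q) - 1ℤ ≡ b + M * - q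
  rearrange = solve-∀

pos-x²+y²+1 : ∀ x y → + (x ℕ.* x ℕ.+ y ℕ.* y ℕ.+ 1) ≡ + x * + x + + y * + y + 1ℤ
pos-x²+y²+1 x y = begin
  + (x ℕ.* x ℕ.+ y ℕ.* y ℕ.+ 1)   ≡⟨ ℤ.pos-+ (x ℕ.* x ℕ.+ y ℕ.* y) 1 ⟩
  + (x ℕ.* x ℕ.+ y ℕ.* y) + 1ℤ    ≡⟨ cong (_+ 1ℤ) (ℤ.pos-+ (x ℕ.* x) (y ℕ.* y)) ⟩
  + (x ℕ.* x) + + (y ℕ.* y) + 1ℤ  ≡⟨ cong (_+ 1ℤ) (cong₂ _+_ (ℤ.pos-* x x) (ℤ.pos-* y y)) ⟩
  + x * + x + + y * + y + 1ℤ      ∎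
  where open ≡-Reasoning

2h²+1<[1+2h]² : ∀ {h} → 0 < h → h ℕ.* h ℕ.+ h ℕ.* h ℕ.+ 1 < suc (2 ℕ.* h) ℕ.* suc (2 ℕ.* h)
2h²+1<[1+2h]² {h@(suc _)} _ =
  subst (h ℕ.* h ℕ.+ h ℕ.* h ℕ.+ 1 <_) (expand h) (ℕ.m<m+n (h ℕ.* h ℕ.+ h ℕ.* h ℕ.+ 1) ℕ.z<s)
  where
  expand : ∀ h → h ℕ.* h ℕ.+ h ℕ.* h ℕ.+ 1 ℕ.+ 2 ℕ.* h ℕ.* (h ℕ.+ 2) ≡ suc (2 ℕ.* h) ℕ.* suc (2 ℕ.* h)
  expand = ℕ-Solver.solve-∀

-- The p + 1 integers x² and −1 − y² (0 ≤ x, y ≤ h) cannot be pairwise incongruent mod p, and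
-- within each family they are; so some x² ≡ −1 − y².
module OddPrime {p h} (p-prime : Prime p) (p≡1+2h : p ≡ suc (2 ℕ.* h)) where

  private instance
    p≢0 : NonZero p
    p≢0 = prime⇒nonZero p-prime

  values : Fin (suc h) ⊎ Fin (suc h) → ℤ
  values (inj₁ x) = + toℕ x * + toℕ x
  values (inj₂ y) = - (1ℤ + + toℕ y * + toℕ y)

  residue : ℤ → Fin p
  residue z = fromℕ< (n%ℕd<d z p)

  p<2[h+1] : p < suc h ℕ.+ suc h
  p<2[h+1] = subst (_< suc h ℕ.+ suc h) (sym p≡1+2h)
    (s≤s (ℕ.+-monoʳ-< h (s≤s (ℕ.≤-reflexive (ℕ.+-identityʳ h)))))

  ≤h+≤h⇒<p : ∀ {x y} → x ≤ h → y ≤ h → x ℕ.+ y < p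
  ≤h+≤h⇒<p {x} {y} x≤h y≤h = subst (x ℕ.+ y <_) (sym p≡1+2h)
    (s≤s (subst (x ℕ.+ y ≤_) (cong (h ℕ.+_) (sym (ℕ.+-identityʳ h))) (ℕ.+-mono-≤ x≤h y≤h)))

  squares-distinct : ∀ {x y : Fin (suc h)} → + toℕ x * + toℕ x ≡ + toℕ y * + toℕ y [mod p ] → x ≡ y
  squares-distinct {x} {y} x²≡y² = Fin.toℕ-injective
    (squares-injective-mod p-prime (≤h+≤h⇒<p (ℕ.s≤s⁻¹ (Fin.toℕ<n x)) (ℕ.s≤s⁻¹ (Fin.toℕ<n y))) x²≡y²)

  p∣x²+y²+1 : ∀ x y → + x * + x ≡ - (1ℤ + + y * + y) [mod p ] → p ∣ x ℕ.* x ℕ.+ y ℕ.* y ℕ.+ 1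
  p∣x²+y²+1 x y (congruent q eq) = +≡+[mod]⇒∣∸ (congruent q (begin
    + (x ℕ.* x ℕ.+ y ℕ.* y ℕ.+ 1)                  ≡⟨ pos-x²+y²+1 x y ⟩
    + x * + x + + y * + y + 1ℤ                     ≡⟨ cong (λ z → z + + y * + y + 1ℤ) eq ⟩
    - (1ℤ + + y * + y) + + p * q + + y * + y + 1ℤ  ≡⟨ cancel (+ y * + y) (+ p * q) ⟩
    + 0 + + p * q                                  ∎))
    where
    open ≡-Reasoning
    cancel : ∀ Y Q → - (1ℤ + Y) + Q + Y + 1ℤ ≡ + 0 + Q
    cancel = solve-∀

  ∃p∣x²+y²+1 : ∃[ x ] ∃[ y ] x ≤ h × y ≤ h × p ∣ x ℕ.* x ℕ.+ y ℕ.* y ℕ.+ 1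
  ∃p∣x²+y²+1 with s , t , s≢t , rs≡rt ← pigeonhole-⊎ p<2[h+1] (residue ∘ values) =
    collision s t s≢t (%ℕ-≡⇒≡[mod] (values s) (values t)
      (trans (sym (Fin.toℕ-fromℕ< _)) (trans (cong toℕ rs≡rt) (Fin.toℕ-fromℕ< _))))
    where
    bounded : ∀ (x y : Fin (suc h)) → p ∣ toℕ x ℕ.* toℕ x ℕ.+ toℕ y ℕ.* toℕ y ℕ.+ 1 →
              ∃[ x ] ∃[ y ] x ≤ h × y ≤ h × p ∣ x ℕ.* x ℕ.+ y ℕ.* y ℕ.+ 1
    bounded x y p∣ = toℕ x , toℕ y , ℕ.s≤s⁻¹ (Fin.toℕ<n x) , ℕ.s≤s⁻¹ (Fin.toℕ<n y) , p∣
    collision : ∀ s t → s ≢ t → values s ≡ values t [mod p ] →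
                ∃[ x ] ∃[ y ] x ≤ h × y ≤ h × p ∣ x ℕ.* x ℕ.+ y ℕ.* y ℕ.+ 1
    collision (inj₁ x) (inj₁ y) x≢y eq = contradiction (cong inj₁ (squares-distinct eq)) x≢y
    collision (inj₂ x) (inj₂ y) x≢y eq = contradiction
      (cong inj₂ (squares-distinct (neg-suc-cancel-≡[mod] {p} (+ toℕ x * + toℕ x) (+ toℕ y * + toℕ y) eq))) x≢y
    collision (inj₁ x) (inj₂ y) _ eq = bounded x y (p∣x²+y²+1 (toℕ x) (toℕ y) eq)
    collision (inj₂ y) (inj₁ x) _ eq = bounded x y (p∣x²+y²+1 (toℕ x) (toℕ y) (≡[mod]-sym {m = p} eq))

  small-multiple-sumSq₄ : ∃[ m ] 0 < m × m < p × IsSumSq₄ (+ m * + p)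
  small-multiple-sumSq₄ = from-divisibility ∃p∣x²+y²+1
    where
    0<h : 0 < h
    0<h = ℕ.n≢0⇒n>0 λ h≡0 → ¬prime[1] (subst Prime (trans p≡1+2h (cong (λ k → suc (2 ℕ.* k)) h≡0)) p-prime)
    from-divisibility : ∃[ x ] ∃[ y ] x ≤ h × y ≤ h × p ∣ x ℕ.* x ℕ.+ y ℕ.* y ℕ.+ 1 →
                        ∃[ m ] 0 < m × m < p × IsSumSq₄ (+ m * + p)
    from-divisibility (x , y , x≤h , y≤h , divides m x²+y²+1≡mp) =
      m , 0<m , m<p , + x , + y , 1ℤ , 0ℤ , (begin
        + m * + p                      ≡⟨ ℤ.pos-* m p ⟨
        + (m ℕ.* p)                    ≡⟨ cong +_ x²+y²+1≡mp ⟨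
        + (x ℕ.* x ℕ.+ y ℕ.* y ℕ.+ 1)  ≡⟨ pos-x²+y²+1 x y ⟩
        + x * + x + + y * + y + 1ℤ     ≡⟨ ℤ.+-identityʳ _ ⟨
        sumSq₄ (+ x) (+ y) 1ℤ 0ℤ       ∎)
      where
      open ≡-Reasoning
      0<m : 0 < m
      0<m = ℕ.n≢0⇒n>0 λ m≡0 →
        contradiction (ℕ.m+n≡0⇒n≡0 (x ℕ.* x ℕ.+ y ℕ.* y) (trans x²+y²+1≡mp (cong (ℕ._* p) m≡0))) λ ()
      m<p : m < p
      m<p = ℕ.*-cancelʳ-< p m p (ℕ.≤-<-trans
        (subst (_≤ h ℕ.* h ℕ.+ h ℕ.* h ℕ.+ 1) x²+y²+1≡mp
          (ℕ.+-monoˡ-≤ 1 (ℕ.+-mono-≤ (ℕ.*-mono-≤ x≤h x≤h) (ℕ.*-mono-≤ y≤h y≤h))))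
        (subst (λ q → h ℕ.* h ℕ.+ h ℕ.* h ℕ.+ 1 < q ℕ.* q) (sym p≡1+2h) (2h²+1<[1+2h]² {h} 0<h)))

-- Euler's descent

≤∧≤∧+≡+⇒≡ : ∀ {a b k l} → a ≤ k → b ≤ l → a ℕ.+ b ≡ k ℕ.+ l → a ≡ k × b ≡ l
≤∧≤∧+≡+⇒≡ {a} {b} {k} {l} a≤k b≤l eq =
  ℕ.≤-antisym a≤k (ℕ.+-cancelʳ-≤ l k a (subst (_≤ a ℕ.+ l) eq (ℕ.+-monoʳ-≤ a b≤l))) ,
  ℕ.≤-antisym b≤l (ℕ.+-cancelˡ-≤ k l b (subst (_≤ k ℕ.+ b) eq (ℕ.+-monoˡ-≤ b a≤k)))

≤∧square≡⇒≡ : ∀ {a b} → a ≤ b → a ℕ.* a ≡ b ℕ.* b → a ≡ b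
≤∧square≡⇒≡ a≤b eq with ℕ.m≤n⇒m<n∨m≡n a≤b
... | inj₁ a<b = contradiction eq (ℕ.<⇒≢ (ℕ.*-mono-< a<b a<b))
... | inj₂ a≡b = a≡b

square≡0⇒≡0 : ∀ {a} → a ℕ.* a ≡ 0 → a ≡ 0
square≡0⇒≡0 {a} a²≡0 with ℕ.m*n≡0⇒m≡0∨n≡0 a a²≡0
... | inj₁ a≡0 = a≡0
... | inj₂ a≡0 = a≡0

sumSq≡0⇒≡0 : ∀ {a b c d} → a ℕ.* a ℕ.+ b ℕ.* b ℕ.+ c ℕ.* c ℕ.+ d ℕ.* d ≡ 0 → a ≡ 0 × b ≡ 0 × c ≡ 0 × d ≡ 0
sumSq≡0⇒≡0 {a} S≡0 =
  square≡0⇒≡0 (ℕ.m+n≡0⇒m≡0 _ ab≡0) , square≡0⇒≡0 (ℕ.m+n≡0⇒n≡0 (a ℕ.* a) ab≡0) ,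
  square≡0⇒≡0 (ℕ.m+n≡0⇒n≡0 _ abc≡0) , square≡0⇒≡0 (ℕ.m+n≡0⇒n≡0 _ S≡0)
  where
  abc≡0 = ℕ.m+n≡0⇒m≡0 _ S≡0
  ab≡0  = ℕ.m+n≡0⇒m≡0 _ abc≡0

4*sumSq≡sumSq-doubled : ∀ a b c d → 4 ℕ.* (a ℕ.* a ℕ.+ b ℕ.* b ℕ.+ c ℕ.* c ℕ.+ d ℕ.* d) ≡
  (2 ℕ.* a) ℕ.* (2 ℕ.* a) ℕ.+ (2 ℕ.* b) ℕ.* (2 ℕ.* b) ℕ.+ (2 ℕ.* c) ℕ.* (2 ℕ.* c) ℕ.+ (2 ℕ.* d) ℕ.* (2 ℕ.* d)
4*sumSq≡sumSq-doubled = ℕ-Solver.solve-∀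

module _ {m : ℕ} (a b c d : ℕ)
         (2a≤m : 2 ℕ.* a ≤ m) (2b≤m : 2 ℕ.* b ≤ m) (2c≤m : 2 ℕ.* c ≤ m) (2d≤m : 2 ℕ.* d ≤ m) where

  private
    mm = m ℕ.* m

    square-≤ : ∀ x → 2 ℕ.* x ≤ m → (2 ℕ.* x) ℕ.* (2 ℕ.* x) ≤ mm
    square-≤ _ 2x≤m = ℕ.*-mono-≤ 2x≤m 2x≤m

    4*≡+++ : ∀ x → 4 ℕ.* x ≡ x ℕ.+ x ℕ.+ x ℕ.+ x
    4*≡+++ = ℕ-Solver.solve-∀

  halves-sumSq-≤ : a ℕ.* a ℕ.+ b ℕ.* b ℕ.+ c ℕ.* c ℕ.+ d ℕ.* d ≤ mm
  halves-sumSq-≤ = ℕ.*-cancelˡ-≤ 4 (subst₂ _≤_ (sym (4*sumSq≡sumSq-doubled a b c d)) (sym (4*≡+++ mm))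
    (ℕ.+-mono-≤ (ℕ.+-mono-≤ (ℕ.+-mono-≤ (square-≤ a 2a≤m) (square-≤ b 2b≤m)) (square-≤ c 2c≤m))
                (square-≤ d 2d≤m)))

  halves-sumSq-≡ : a ℕ.* a ℕ.+ b ℕ.* b ℕ.+ c ℕ.* c ℕ.+ d ℕ.* d ≡ mm →
                   2 ℕ.* a ≡ m × 2 ℕ.* b ≡ m × 2 ℕ.* c ≡ m × 2 ℕ.* d ≡ m
  halves-sumSq-≡ S≡mm =
    ≤∧square≡⇒≡ 2a≤m (proj₁ ab) , ≤∧square≡⇒≡ 2b≤m (proj₂ ab) ,
    ≤∧square≡⇒≡ 2c≤m (proj₂ abc) , ≤∧square≡⇒≡ 2d≤m (proj₂ abcd)
    where
    abcd = ≤∧≤∧+≡+⇒≡ (ℕ.+-mono-≤ (ℕ.+-mono-≤ (square-≤ a 2a≤m) (square-≤ b 2b≤m)) (square-≤ c 2c≤m))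
                     (square-≤ d 2d≤m)
             (trans (sym (4*sumSq≡sumSq-doubled a b c d)) (trans (cong (4 ℕ.*_) S≡mm) (4*≡+++ mm)))
    abc  = ≤∧≤∧+≡+⇒≡ (ℕ.+-mono-≤ (square-≤ a 2a≤m) (square-≤ b 2b≤m)) (square-≤ c 2c≤m) (proj₁ abcd)
    ab   = ≤∧≤∧+≡+⇒≡ (square-≤ a 2a≤m) (square-≤ b 2b≤m) (proj₁ abc)

-- A representative r ≡ x (mod m) with |r| ≤ m/2. For even m the residue m/2 is represented by
-- +m/2, so that when all four representatives have |r| = m/2 they coincide.
record BalancedResidue (m : ℕ) (x : ℤ) : Set where
  constructor balanced
  field
    r            : ℤ
    x≡r          : x ≡ r [mod m ]
    2∣r∣≤m       : 2 ℕ.* ∣ r ∣ ≤ m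
    2∣r∣≡m⇒r≥0   : 2 ℕ.* ∣ r ∣ ≡ m → r ≡ + ∣ r ∣

balancedResidue : ∀ m .{{_ : NonZero m}} x → BalancedResidue m x
balancedResidue m x = choose (2 ℕ.* ρ ℕ.≤? m)
  where
  ρ = x %ℕ m
  κ = x /ℕ m
  x≡ρ+κm : x ≡ + ρ + κ * + m
  x≡ρ+κm = a≡a%ℕn+[a/ℕn]*n x m
  choose : Dec (2 ℕ.* ρ ≤ m) → BalancedResidue m x
  choose (yes 2ρ≤m) =
    balanced (+ ρ) (congruent κ (trans x≡ρ+κm (cong (_+_ (+ ρ)) (ℤ.*-comm κ (+ m))))) 2ρ≤m (λ _ → refl)
  choose (no 2ρ≰m)  = balanced (- + a) (congruent (κ + 1ℤ) x≡-a+m[κ+1]) 2a≤m 2a≢m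
    where
    a = m ∸ ρ
    a+ρ≡m : a ℕ.+ ρ ≡ m
    a+ρ≡m = ℕ.m∸n+n≡m (ℕ.<⇒≤ (n%ℕd<d x m))
    2a<m : 2 ℕ.* a < m
    2a<m = ℕ.+-cancelʳ-< m (2 ℕ.* a) m (begin-strict
      2 ℕ.* a ℕ.+ m        <⟨ ℕ.+-monoʳ-< (2 ℕ.* a) (ℕ.≰⇒> 2ρ≰m) ⟩
      2 ℕ.* a ℕ.+ 2 ℕ.* ρ  ≡⟨ ℕ.*-distribˡ-+ 2 a ρ ⟨
      2 ℕ.* (a ℕ.+ ρ)      ≡⟨ cong (2 ℕ.*_) a+ρ≡m ⟩
      2 ℕ.* m              ≡⟨ cong (m ℕ.+_) (ℕ.+-identityʳ m) ⟩
      m ℕ.+ m              ∎)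
      where open ℕ.≤-Reasoning
    2a≤m : 2 ℕ.* ∣ - + a ∣ ≤ m
    2a≤m rewrite ℤ.∣-i∣≡∣i∣ (+ a) = ℕ.<⇒≤ 2a<m
    2a≢m : 2 ℕ.* ∣ - + a ∣ ≡ m → - + a ≡ + ∣ - + a ∣
    2a≢m rewrite ℤ.∣-i∣≡∣i∣ (+ a) = λ 2a≡m → contradiction 2a≡m (ℕ.<⇒≢ 2a<m)
    shift : ∀ A R K → R + K * (A + R) ≡ - A + (A + R) * (K + 1ℤ)
    shift = solve-∀
    x≡-a+m[κ+1] : x ≡ - + a + + m * (κ + 1ℤ)
    x≡-a+m[κ+1] = trans x≡ρ+κm
      (subst (λ M → + ρ + κ * M ≡ - + a + M * (κ + 1ℤ)) (trans (sym (ℤ.pos-+ a ρ)) (cong +_ a+ρ≡m))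
        (shift (+ a) (+ ρ) κ))

+m*i≡+n⇒i≡+k : ∀ m .{{_ : NonZero m}} i {n} → + m * i ≡ + n → ∃[ k ] i ≡ + k
+m*i≡+n⇒i≡+k (suc m) (+ k) _ = k , refl

sumSq₄-expand : ∀ r₁ r₂ r₃ r₄ q₁ q₂ q₃ q₄ M →
  (r₁ + M * q₁) * (r₁ + M * q₁) + (r₂ + M * q₂) * (r₂ + M * q₂) +
  (r₃ + M * q₃) * (r₃ + M * q₃) + (r₄ + M * q₄) * (r₄ + M * q₄) ≡
  r₁ * r₁ + r₂ * r₂ + r₃ * r₃ + r₄ * r₄ +
  M * (+ 2 * (r₁ * q₁ + r₂ * q₂ + r₃ * q₃ + r₄ * q₄) +
       M * (q₁ * q₁ + q₂ * q₂ + q₃ * q₃ + q₄ * q₄))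
sumSq₄-expand = solve-∀

-- Euler's identity for x = r + M q: the first component becomes Σ r² + M Σ q r,
-- and in the other three the r-terms cancel, leaving multiples of M.
euler-four-square-shifted : ∀ r₁ r₂ r₃ r₄ q₁ q₂ q₃ q₄ M →
  ((r₁ + M * q₁) * (r₁ + M * q₁) + (r₂ + M * q₂) * (r₂ + M * q₂) +
   (r₃ + M * q₃) * (r₃ + M * q₃) + (r₄ + M * q₄) * (r₄ + M * q₄)) *
  (r₁ * r₁ + r₂ * r₂ + r₃ * r₃ + r₄ * r₄) ≡
  (r₁ * r₁ + r₂ * r₂ + r₃ * r₃ + r₄ * r₄ + M * (q₁ * r₁ + q₂ * r₂ + q₃ * r₃ + q₄ * r₄)) *
  (r₁ * r₁ + r₂ * r₂ + r₃ * r₃ + r₄ * r₄ + M * (q₁ * r₁ + q₂ * r₂ + q₃ * r₃ + q₄ * r₄)) +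
  (M * (q₁ * r₂ - q₂ * r₁ + q₃ * r₄ - q₄ * r₃)) * (M * (q₁ * r₂ - q₂ * r₁ + q₃ * r₄ - q₄ * r₃)) +
  (M * (q₁ * r₃ - q₂ * r₄ - q₃ * r₁ + q₄ * r₂)) * (M * (q₁ * r₃ - q₂ * r₄ - q₃ * r₁ + q₄ * r₂)) +
  (M * (q₁ * r₄ + q₂ * r₃ - q₃ * r₂ - q₄ * r₁)) * (M * (q₁ * r₄ + q₂ * r₃ - q₃ * r₂ - q₄ * r₁))
euler-four-square-shifted = solve-∀

sumSq₄-residues : ∀ M P r₁ r₂ r₃ r₄ q₁ q₂ q₃ q₄ →
  M * P ≡ sumSq₄ (r₁ + M * q₁) (r₂ + M * q₂) (r₃ + M * q₃) (r₄ + M * q₄) →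
  ∃[ R ] sumSq₄ r₁ r₂ r₃ r₄ ≡ M * R
sumSq₄-residues M P r₁ r₂ r₃ r₄ q₁ q₂ q₃ q₄ MP≡Σx² = P - C , (begin
  S               ≡⟨ cancel S (M * C) ⟩
  S + M * C - M * C ≡⟨ cong (_- M * C) (trans MP≡Σx² (sumSq₄-expand r₁ r₂ r₃ r₄ q₁ q₂ q₃ q₄ M)) ⟨
  M * P - M * C   ≡⟨ factor M P C ⟩
  M * (P - C)     ∎)
  where
  open ≡-Reasoning
  S = sumSq₄ r₁ r₂ r₃ r₄
  C = + 2 * (r₁ * q₁ + r₂ * q₂ + r₃ * q₃ + r₄ * q₄) + M * (q₁ * q₁ + q₂ * q₂ + q₃ * q₃ + q₄ * q₄)
  cancel : ∀ S D → S ≡ S + D - D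
  cancel = solve-∀
  factor : ∀ M P C → M * P - M * C ≡ M * (P - C)
  factor = solve-∀

descent-step : ∀ m .{{_ : NonZero m}} P N r₁ r₂ r₃ r₄ q₁ q₂ q₃ q₄ → let M = + m in
  M * P ≡ sumSq₄ (r₁ + M * q₁) (r₂ + M * q₂) (r₃ + M * q₃) (r₄ + M * q₄) →
  sumSq₄ r₁ r₂ r₃ r₄ ≡ M * N → IsSumSq₄ (N * P)
descent-step m P N r₁ r₂ r₃ r₄ q₁ q₂ q₃ q₄ MP≡Σx² Σr²≡MN =
  N + s , w₂ , w₃ , w₄ , ℤ.*-cancelˡ-≡ M _ _ (ℤ.*-cancelˡ-≡ M _ _ (begin
    M * (M * (N * P))                        ≡⟨ swap M N P ⟩
    M * P * (M * N)                          ≡⟨ cong₂ _*_ MP≡Σx² (sym Σr²≡MN) ⟩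
    sumSq₄ (r₁ + M * q₁) (r₂ + M * q₂) (r₃ + M * q₃) (r₄ + M * q₄) * S
                                             ≡⟨ euler-four-square-shifted r₁ r₂ r₃ r₄ q₁ q₂ q₃ q₄ M ⟩
    sumSq₄ (S + M * s) (M * w₂) (M * w₃) (M * w₄)
                                   ≡⟨ cong (λ T → sumSq₄ (T + M * s) (M * w₂) (M * w₃) (M * w₄)) Σr²≡MN ⟩
    sumSq₄ (M * N + M * s) (M * w₂) (M * w₃) (M * w₄)
                                             ≡⟨ factor M N s w₂ w₃ w₄ ⟩
    M * (M * sumSq₄ (N + s) w₂ w₃ w₄)        ∎))
  where
  open ≡-Reasoning
  M  = + m
  S  = sumSq₄ r₁ r₂ r₃ r₄
  s  = q₁ * r₁ + q₂ * r₂ + q₃ * r₃ + q₄ * r₄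
  w₂ = q₁ * r₂ - q₂ * r₁ + q₃ * r₄ - q₄ * r₃
  w₃ = q₁ * r₃ - q₂ * r₄ - q₃ * r₁ + q₄ * r₂
  w₄ = q₁ * r₄ + q₂ * r₃ - q₃ * r₂ - q₄ * r₁
  swap : ∀ M N P → M * (M * (N * P)) ≡ M * P * (M * N)
  swap = solve-∀
  factor : ∀ M N s w₂ w₃ w₄ →
    (M * N + M * s) * (M * N + M * s) + M * w₂ * (M * w₂) + M * w₃ * (M * w₃) + M * w₄ * (M * w₄) ≡
    M * (M * ((N + s) * (N + s) + w₂ * w₂ + w₃ * w₃ + w₄ * w₄))
  factor = solve-∀

-- If m p = Σ xᵢ² with 1 < m < p, the representatives rᵢ of xᵢ mod m satisfy Σ rᵢ² = m n with
-- 0 < n < m (n = 0 or n = m would force m² ∣ m p), and Euler's identity for (Σ xᵢ²)(Σ rᵢ²)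
-- has all four components divisible by m, so n p is again a sum of four squares.
module Descent {m p : ℕ} (p-prime : Prime p) (1<m : 1 < m) (m<p : m < p) where

  private instance
    m≢0 : NonZero m
    m≢0 = ℕ.>-nonZero (ℕ.<-trans ℕ.z<s 1<m)

  M = + m

  m∤p : ¬ m ∣ p
  m∤p m∣p with prime⇒irreducible p-prime m∣p
  ... | inj₁ m≡1 = ℕ.<⇒≢ 1<m (sym m≡1)
  ... | inj₂ m≡p = ℕ.<⇒≢ m<p m≡p

  mp≢m[mk] : ∀ k → M * + p ≢ M * (M * k)
  mp≢m[mk] k eq = m∤p (divides ∣ k ∣ (begin
    p              ≡⟨ cong ∣_∣ (ℤ.*-cancelˡ-≡ M (+ p) (M * k) eq) ⟩
    ∣ M * k ∣      ≡⟨ ℤ.abs-* M k ⟩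
    m ℕ.* ∣ k ∣    ≡⟨ ℕ.*-comm m ∣ k ∣ ⟩
    ∣ k ∣ ℕ.* m    ∎))
    where open ≡-Reasoning

  residues-not-zero : ∀ r₁ r₂ r₃ r₄ q₁ q₂ q₃ q₄ → r₁ ≡ 0ℤ → r₂ ≡ 0ℤ → r₃ ≡ 0ℤ → r₄ ≡ 0ℤ →
    M * + p ≢ sumSq₄ (r₁ + M * q₁) (r₂ + M * q₂) (r₃ + M * q₃) (r₄ + M * q₄)
  residues-not-zero _ _ _ _ q₁ q₂ q₃ q₄ refl refl refl refl eq =
    mp≢m[mk] (sumSq₄ q₁ q₂ q₃ q₄) (trans eq (scale M q₁ q₂ q₃ q₄))
    where
    scale : ∀ M q₁ q₂ q₃ q₄ →
      (0ℤ + M * q₁) * (0ℤ + M * q₁) + (0ℤ + M * q₂) * (0ℤ + M * q₂) +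
      (0ℤ + M * q₃) * (0ℤ + M * q₃) + (0ℤ + M * q₄) * (0ℤ + M * q₄) ≡
      M * (M * (q₁ * q₁ + q₂ * q₂ + q₃ * q₃ + q₄ * q₄))
    scale = solve-∀

  residues-not-half : ∀ {a} → 2 ℕ.* a ≡ m → ∀ r₁ r₂ r₃ r₄ q₁ q₂ q₃ q₄ →
    r₁ ≡ + a → r₂ ≡ + a → r₃ ≡ + a → r₄ ≡ + a →
    M * + p ≢ sumSq₄ (r₁ + M * q₁) (r₂ + M * q₂) (r₃ + M * q₃) (r₄ + M * q₄)
  residues-not-half {a} 2a≡m _ _ _ _ q₁ q₂ q₃ q₄ refl refl refl refl eq = mp≢m[mk] _ (trans eq
    (subst (λ M → sumSq₄ (+ a + M * q₁) (+ a + M * q₂) (+ a + M * q₃) (+ a + M * q₄) ≡ M * (M * _))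
      (trans (sym (ℤ.pos-* 2 a)) (cong +_ 2a≡m)) (scale (+ a) q₁ q₂ q₃ q₄)))
    where
    scale : ∀ A q₁ q₂ q₃ q₄ →
      (A + + 2 * A * q₁) * (A + + 2 * A * q₁) + (A + + 2 * A * q₂) * (A + + 2 * A * q₂) +
      (A + + 2 * A * q₃) * (A + + 2 * A * q₃) + (A + + 2 * A * q₄) * (A + + 2 * A * q₄) ≡
      + 2 * A * (+ 2 * A * (q₁ * q₁ + q₂ * q₂ + q₃ * q₃ + q₄ * q₄ + q₁ + q₂ + q₃ + q₄ + 1ℤ))
    scale = solve-∀

  module _ (r₁ r₂ r₃ r₄ q₁ q₂ q₃ q₄ : ℤ)
           (mp≡Σx² : M * + p ≡ sumSq₄ (r₁ + M * q₁) (r₂ + M * q₂) (r₃ + M * q₃) (r₄ + M * q₄))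
           {n : ℕ} (Σr²≡mn : sumSq₄ r₁ r₂ r₃ r₄ ≡ M * + n) where

    private
      mn≡Σ∣r∣² : m ℕ.* n ≡ ∣ r₁ ∣ ℕ.* ∣ r₁ ∣ ℕ.+ ∣ r₂ ∣ ℕ.* ∣ r₂ ∣ ℕ.+ ∣ r₃ ∣ ℕ.* ∣ r₃ ∣ ℕ.+ ∣ r₄ ∣ ℕ.* ∣ r₄ ∣
      mn≡Σ∣r∣² = ℤ.+-injective (trans (ℤ.pos-* m n) (trans (sym Σr²≡mn) (sumSq₄-abs r₁ r₂ r₃ r₄)))

    cofactor-≢0 : n ≢ 0
    cofactor-≢0 n≡0 = all-zero (sumSq≡0⇒≡0 (trans (sym mn≡Σ∣r∣²) (trans (cong (m ℕ.*_) n≡0) (ℕ.*-zeroʳ m))))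
      where
      all-zero : ∣ r₁ ∣ ≡ 0 × ∣ r₂ ∣ ≡ 0 × ∣ r₃ ∣ ≡ 0 × ∣ r₄ ∣ ≡ 0 → ⊥
      all-zero (a₁≡0 , a₂≡0 , a₃≡0 , a₄≡0) = residues-not-zero r₁ r₂ r₃ r₄ q₁ q₂ q₃ q₄
        (ℤ.∣i∣≡0⇒i≡0 a₁≡0) (ℤ.∣i∣≡0⇒i≡0 a₂≡0) (ℤ.∣i∣≡0⇒i≡0 a₃≡0) (ℤ.∣i∣≡0⇒i≡0 a₄≡0) mp≡Σx²

    module _ (2a₁≤m : 2 ℕ.* ∣ r₁ ∣ ≤ m) (2a₂≤m : 2 ℕ.* ∣ r₂ ∣ ≤ m)
             (2a₃≤m : 2 ℕ.* ∣ r₃ ∣ ≤ m) (2a₄≤m : 2 ℕ.* ∣ r₄ ∣ ≤ m) where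

      cofactor-≤ : n ≤ m
      cofactor-≤ = ℕ.*-cancelˡ-≤ m (subst (_≤ m ℕ.* m) (sym mn≡Σ∣r∣²)
        (halves-sumSq-≤ (∣ r₁ ∣) (∣ r₂ ∣) (∣ r₃ ∣) (∣ r₄ ∣) 2a₁≤m 2a₂≤m 2a₃≤m 2a₄≤m))

      cofactor-≢m : (2 ℕ.* ∣ r₁ ∣ ≡ m → r₁ ≡ + ∣ r₁ ∣) → (2 ℕ.* ∣ r₂ ∣ ≡ m → r₂ ≡ + ∣ r₂ ∣) →
                    (2 ℕ.* ∣ r₃ ∣ ≡ m → r₃ ≡ + ∣ r₃ ∣) → (2 ℕ.* ∣ r₄ ∣ ≡ m → r₄ ≡ + ∣ r₄ ∣) → n ≢ m
      cofactor-≢m r₁≥0 r₂≥0 r₃≥0 r₄≥0 n≡m = all-halves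
        (halves-sumSq-≡ (∣ r₁ ∣) (∣ r₂ ∣) (∣ r₃ ∣) (∣ r₄ ∣) 2a₁≤m 2a₂≤m 2a₃≤m 2a₄≤m
          (trans (sym mn≡Σ∣r∣²) (cong (m ℕ.*_) n≡m)))
        where
        all-halves : 2 ℕ.* ∣ r₁ ∣ ≡ m × 2 ℕ.* ∣ r₂ ∣ ≡ m × 2 ℕ.* ∣ r₃ ∣ ≡ m × 2 ℕ.* ∣ r₄ ∣ ≡ m → ⊥
        all-halves (2a₁≡m , 2a₂≡m , 2a₃≡m , 2a₄≡m) = residues-not-half 2a₁≡m r₁ r₂ r₃ r₄ q₁ q₂ q₃ q₄
          (r₁≥0 2a₁≡m) (≡r₁ r₂≥0 2a₂≡m) (≡r₁ r₃≥0 2a₃≡m) (≡r₁ r₄≥0 2a₄≡m) mp≡Σx²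
          where
          ≡r₁ : ∀ {r} → (2 ℕ.* ∣ r ∣ ≡ m → r ≡ + ∣ r ∣) → 2 ℕ.* ∣ r ∣ ≡ m → r ≡ + ∣ r₁ ∣
          ≡r₁ {r} r≥0 2a≡m = trans (r≥0 2a≡m) (cong +_ (ℕ.*-cancelˡ-≡ ∣ r ∣ ∣ r₁ ∣ 2 (trans 2a≡m (sym 2a₁≡m))))

  descent : IsSumSq₄ (M * + p) → ∃[ n ] 0 < n × n < m × IsSumSq₄ (+ n * + p)
  descent (x₁ , x₂ , x₃ , x₄ , mp≡Σx²) =
    reduce (balancedResidue m x₁) (balancedResidue m x₂) (balancedResidue m x₃) (balancedResidue m x₄) mp≡Σx²
    where
    reduce : ∀ {x₁ x₂ x₃ x₄} → BalancedResidue m x₁ → BalancedResidue m x₂ → BalancedResidue m x₃ →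
             BalancedResidue m x₄ → M * + p ≡ sumSq₄ x₁ x₂ x₃ x₄ → ∃[ n ] 0 < n × n < m × IsSumSq₄ (+ n * + p)
    reduce (balanced r₁ (congruent q₁ refl) 2a₁≤m r₁≥0) (balanced r₂ (congruent q₂ refl) 2a₂≤m r₂≥0)
           (balanced r₃ (congruent q₃ refl) 2a₃≤m r₃≥0) (balanced r₄ (congruent q₄ refl) 2a₄≤m r₄≥0) mp≡Σx² =
      conclude (sumSq₄-residues M (+ p) r₁ r₂ r₃ r₄ q₁ q₂ q₃ q₄ mp≡Σx²)
      where
      conclude : ∃[ R ] sumSq₄ r₁ r₂ r₃ r₄ ≡ M * R → ∃[ n ] 0 < n × n < m × IsSumSq₄ (+ n * + p)
      conclude (R , Σr²≡MR) with n , refl ← +m*i≡+n⇒i≡+k m R (trans (sym Σr²≡MR) (sumSq₄-abs r₁ r₂ r₃ r₄)) =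
        n , ℕ.n≢0⇒n>0 (cofactor-≢0 r₁ r₂ r₃ r₄ q₁ q₂ q₃ q₄ mp≡Σx² Σr²≡MR) ,
        ℕ.≤∧≢⇒< (cofactor-≤ r₁ r₂ r₃ r₄ q₁ q₂ q₃ q₄ mp≡Σx² Σr²≡MR 2a₁≤m 2a₂≤m 2a₃≤m 2a₄≤m)
                (cofactor-≢m r₁ r₂ r₃ r₄ q₁ q₂ q₃ q₄ mp≡Σx² Σr²≡MR 2a₁≤m 2a₂≤m 2a₃≤m 2a₄≤m
                             r₁≥0 r₂≥0 r₃≥0 r₄≥0) ,
        descent-step m (+ p) (+ n) r₁ r₂ r₃ r₄ q₁ q₂ q₃ q₄ mp≡Σx² Σr²≡MR

-- Lagrange's four-square theorem

from-multiple : ∀ {p} → Prime p → ∀ m → 0 < m → m < p → IsSumSq₄ (+ m * + p) → IsSumSq₄ (+ p)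
from-multiple {p} p-prime = <-rec _ descend
  where
  descend : ∀ m → (∀ {n} → n < m → 0 < n → n < p → IsSumSq₄ (+ n * + p) → IsSumSq₄ (+ p)) →
            0 < m → m < p → IsSumSq₄ (+ m * + p) → IsSumSq₄ (+ p)
  descend m rec 0<m m<p mp with m ℕ.≟ 1
  ... | yes refl = subst IsSumSq₄ (ℤ.*-identityˡ (+ p)) mp
  ... | no m≢1 with n , 0<n , n<m , np ← Descent.descent p-prime (ℕ.≤∧≢⇒< 0<m (m≢1 ∘ sym)) m<p mp =
    rec n<m 0<n (ℕ.<-trans n<m m<p) np

lagrange-prime : ∀ {p} → Prime p → IsSumSq₄ (+ p)
lagrange-prime {p} p-prime = by-parity (p ℕ.% 2) (m%n<n p 2) (m≡m%n+[m/n]*n p 2)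
  where
  two : 2 ≡ 1 ⊎ 2 ≡ p → IsSumSq₄ (+ p)
  two (inj₁ ())
  two (inj₂ 2≡p) = subst (IsSumSq₄ ∘ +_) 2≡p (1ℤ , 1ℤ , 0ℤ , 0ℤ , refl)
  odd : ∃[ m ] 0 < m × m < p × IsSumSq₄ (+ m * + p) → IsSumSq₄ (+ p)
  odd (m , 0<m , m<p , mp) = from-multiple p-prime m 0<m m<p mp
  by-parity : ∀ r → r < 2 → p ≡ r ℕ.+ p ℕ./ 2 ℕ.* 2 → IsSumSq₄ (+ p)
  by-parity 0 _ p≡[p/2]*2   = two (prime⇒irreducible p-prime (divides (p ℕ./ 2) p≡[p/2]*2))
  by-parity 1 _ p≡1+[p/2]*2 = odd (OddPrime.small-multiple-sumSq₄ {h = p ℕ./ 2} p-prime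
                                    (trans p≡1+[p/2]*2 (cong suc (ℕ.*-comm (p ℕ./ 2) 2))))
  by-parity (suc (suc _)) (s≤s (s≤s ())) _

lagrange : ∀ n → IsSumSq₄ (+ n)
lagrange = <-rec _ go
  where
  go : ∀ n → (∀ {m} → m < n → IsSumSq₄ (+ m)) → IsSumSq₄ (+ n)
  go 0 _ = 0ℤ , 0ℤ , 0ℤ , 0ℤ , refl
  go 1 _ = 1ℤ , 0ℤ , 0ℤ , 0ℤ , refl
  go n@(suc (suc _)) rec with composite? n
  ... | no ¬composite = lagrange-prime (¬composite⇒prime ¬composite)
  ... | yes (composite {d} d<n d∣n) =
    subst IsSumSq₄ (trans (sym (ℤ.pos-* q d)) (cong +_ (sym (m∣n⇒n≡quotient*m d∣n))))
      (IsSumSq₄-* (rec q<n) (rec d<n))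
    where
    q = quotient d∣n
    instance _ = quotient≢0 d∣n
    q<n : q < n
    q<n = subst (q <_) (sym (m∣n⇒n≡quotient*m d∣n)) (ℕ.m<m*n q d (nonTrivial⇒n>1 d))

-- Squares prime to 3

Unit₃ : ℤ → Set
Unit₃ x = x ≡ 1ℤ [mod 3 ] ⊎ x ≡ -1ℤ [mod 3 ]

Class₃ : ℤ → Set
Class₃ x = x ≡ 0ℤ [mod 3 ] ⊎ Unit₃ x

units : ∀ {x} → Class₃ x → ℕ
units (inj₁ _) = 0
units (inj₂ _) = 1

classify₃ : ∀ x → Class₃ x
classify₃ x = by-residue (x %ℕ 3) (n%ℕd<d x 3) (a≡a%ℕn+[a/ℕn]*n x 3)
  where
  shift : ∀ r q → + r + q * + 3 ≡ + r + + 3 * q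
  shift r q = cong (_+_ (+ r)) (ℤ.*-comm q (+ 3))
  wrap : ∀ q → + 2 + + 3 * q ≡ -1ℤ + + 3 * (q + 1ℤ)
  wrap = solve-∀
  by-residue : ∀ r → r < 3 → x ≡ + r + x /ℕ 3 * + 3 → Class₃ x
  by-residue 0 _ eq = inj₁ (congruent (x /ℕ 3) (trans eq (shift 0 (x /ℕ 3))))
  by-residue 1 _ eq = inj₂ (inj₁ (congruent (x /ℕ 3) (trans eq (shift 1 (x /ℕ 3)))))
  by-residue 2 _ eq =
    inj₂ (inj₂ (congruent (x /ℕ 3 + 1ℤ) (trans eq (trans (shift 2 (x /ℕ 3)) (wrap (x /ℕ 3))))))
  by-residue (suc (suc (suc _))) (s≤s (s≤s (s≤s ()))) _

square-mod3 : ∀ {x} (c : Class₃ x) → x * x ≡ + units c [mod 3 ]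
square-mod3 (inj₁ (congruent q refl))        = congruent (+ 3 * q * q) (zero² q)
  where
  zero² : ∀ q → (0ℤ + + 3 * q) * (0ℤ + + 3 * q) ≡ + 0 + + 3 * (+ 3 * q * q)
  zero² = solve-∀
square-mod3 (inj₂ (inj₁ (congruent q refl))) = congruent (+ 3 * q * q + + 2 * q) (one² q)
  where
  one² : ∀ q → (1ℤ + + 3 * q) * (1ℤ + + 3 * q) ≡ + 1 + + 3 * (+ 3 * q * q + + 2 * q)
  one² = solve-∀
square-mod3 (inj₂ (inj₂ (congruent q refl))) = congruent (+ 3 * q * q - + 2 * q) (minus-one² q)
  where
  minus-one² : ∀ q → (-1ℤ + + 3 * q) * (-1ℤ + + 3 * q) ≡ + 1 + + 3 * (+ 3 * q * q - + 2 * q)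
  minus-one² = solve-∀

unit⇒3∤ : ∀ {x} → Unit₃ x → ¬ 3 ∣ ∣ x ∣
unit⇒3∤ (inj₁ x≡1) 3∣x = contradiction
  (≡[mod]⇒≡ {3} {0} {1} (s≤s z≤n) (s≤s (s≤s z≤n)) (≡[mod]-trans (≡[mod]-sym (∣∣x∣⇒x≡0[mod] 3∣x)) x≡1)) λ ()
unit⇒3∤ (inj₂ x≡-1) 3∣x = contradiction
  (≡[mod]⇒≡ {3} {0} {2} (s≤s z≤n) (s≤s (s≤s (s≤s z≤n)))
    (≡[mod]-trans (≡[mod]-sym (∣∣x∣⇒x≡0[mod] 3∣x)) (≡[mod]-trans x≡-1 (congruent -1ℤ refl)))) λ ()

sumSq₃ : ℤ → ℤ → ℤ → ℤ
sumSq₃ a b c = a * a + b * b + c * c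

UnitSquares : ℕ → ℤ → Set
UnitSquares k n = Σ (Vector ℤ k) λ z → (∀ i → Unit₃ (z i)) × n ≡ sumℤ (λ i → z i * z i)

unitSquares-[] : UnitSquares 0 0ℤ
unitSquares-[] = [] , (λ ()) , refl

unitSquares-∷ : ∀ {a k n} → Unit₃ a → UnitSquares k n → UnitSquares (suc k) (a * a + n)
unitSquares-∷ {a} a-unit (z , z-units , n≡Σz²) = a ∷ z , units′ , cong (_+_ (a * a)) n≡Σz²
  where
  units′ : ∀ i → Unit₃ ((a ∷ z) i)
  units′ zero    = a-unit
  units′ (suc i) = z-units i

unit-reflect : ∀ v {s} → Unit₃ s → Unit₃ (+ 3 * v - + 2 * s)
unit-reflect v (inj₁ (congruent q refl)) = inj₁ (congruent (v - + 2 * q - 1ℤ) (shift v q))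
  where
  shift : ∀ v q → + 3 * v - + 2 * (1ℤ + + 3 * q) ≡ 1ℤ + + 3 * (v - + 2 * q - 1ℤ)
  shift = solve-∀
unit-reflect v (inj₂ (congruent q refl)) = inj₂ (congruent (v - + 2 * q + 1ℤ) (shift v q))
  where
  shift : ∀ v q → + 3 * v - + 2 * (-1ℤ + + 3 * q) ≡ -1ℤ + + 3 * (v - + 2 * q + 1ℤ)
  shift = solve-∀

-- v ↦ 3v - 2(v₁+v₂+v₃)(1,1,1) is 3 times the reflection in the plane orthogonal to (1,1,1),
-- and it makes every coordinate congruent to the sum v₁+v₂+v₃ mod 3.
nine-sumSq₃-by-reflection : ∀ v₁ v₂ v₃ → Unit₃ (v₁ + v₂ + v₃) → UnitSquares 3 (+ 9 * sumSq₃ v₁ v₂ v₃)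
nine-sumSq₃-by-reflection v₁ v₂ v₃ s-unit = subst (UnitSquares 3) (reflection v₁ v₂ v₃)
  (unitSquares-∷ (unit-reflect v₁ s-unit) (unitSquares-∷ (unit-reflect v₂ s-unit)
    (unitSquares-∷ (unit-reflect v₃ s-unit) unitSquares-[])))
  where
  reflection : ∀ v₁ v₂ v₃ →
    (+ 3 * v₁ - + 2 * (v₁ + v₂ + v₃)) * (+ 3 * v₁ - + 2 * (v₁ + v₂ + v₃)) +
    ((+ 3 * v₂ - + 2 * (v₁ + v₂ + v₃)) * (+ 3 * v₂ - + 2 * (v₁ + v₂ + v₃)) +
     ((+ 3 * v₃ - + 2 * (v₁ + v₂ + v₃)) * (+ 3 * v₃ - + 2 * (v₁ + v₂ + v₃)) + 0ℤ)) ≡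
    + 9 * (v₁ * v₁ + v₂ * v₂ + v₃ * v₃)
  reflection = solve-∀

neg-square : ∀ x → - x * - x ≡ x * x
neg-square = solve-∀

unit-sign-normal : ∀ {x} → Unit₃ x → ∃[ y ] y * y ≡ x * x × (y ≡ 1ℤ [mod 3 ])
unit-sign-normal {x} (inj₁ x≡1)  = x , refl , x≡1
unit-sign-normal {x} (inj₂ x≡-1) = - x , neg-square x , ≡[mod]-neg x≡-1

sign-normal : ∀ {x} → Class₃ x → ∃[ y ] y * y ≡ x * x × (y ≡ 0ℤ [mod 3 ] ⊎ y ≡ 1ℤ [mod 3 ])
sign-normal {x} (inj₁ x≡0) = x , refl , inj₁ x≡0
sign-normal (inj₂ x-unit) with y , y²≡x² , y≡1 ← unit-sign-normal x-unit = y , y²≡x² , inj₂ y≡1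

unit-sum-by-signs : ∀ {v₁} v₂ v₃ → Unit₃ v₁ →
  ∃[ w₁ ] ∃[ w₂ ] ∃[ w₃ ] sumSq₃ w₁ w₂ w₃ ≡ sumSq₃ v₁ v₂ v₃ × Unit₃ (w₁ + w₂ + w₃)
unit-sum-by-signs {v₁} v₂ v₃ v₁-unit
  with w₁ , e₁ , w₁≡1 ← unit-sign-normal v₁-unit
     | w₂ , e₂ , c₂   ← sign-normal (classify₃ v₂)
     | w₃ , e₃ , c₃   ← sign-normal (classify₃ v₃)
     = finish (choose c₂ c₃)
  where
  2≡-1 : + 2 ≡ -1ℤ [mod 3 ]
  2≡-1 = congruent 1ℤ refl
  choose : w₂ ≡ 0ℤ [mod 3 ] ⊎ w₂ ≡ 1ℤ [mod 3 ] → w₃ ≡ 0ℤ [mod 3 ] ⊎ w₃ ≡ 1ℤ [mod 3 ] →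
           ∃[ w ] w * w ≡ w₃ * w₃ × Unit₃ (w₁ + w₂ + w)
  choose (inj₁ w₂≡0) (inj₁ w₃≡0) = w₃ , refl , inj₁ (≡[mod]-+ (≡[mod]-+ w₁≡1 w₂≡0) w₃≡0)
  choose (inj₂ w₂≡1) (inj₁ w₃≡0) = w₃ , refl , inj₂ (≡[mod]-trans (≡[mod]-+ (≡[mod]-+ w₁≡1 w₂≡1) w₃≡0) 2≡-1)
  choose (inj₁ w₂≡0) (inj₂ w₃≡1) = w₃ , refl , inj₂ (≡[mod]-trans (≡[mod]-+ (≡[mod]-+ w₁≡1 w₂≡0) w₃≡1) 2≡-1)
  choose (inj₂ w₂≡1) (inj₂ w₃≡1) = - w₃ , neg-square w₃ , inj₁ (≡[mod]-+ (≡[mod]-+ w₁≡1 w₂≡1) (≡[mod]-neg w₃≡1))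
  finish : ∃[ w ] w * w ≡ w₃ * w₃ × Unit₃ (w₁ + w₂ + w) →
           ∃[ w₁ ] ∃[ w₂ ] ∃[ w₃ ] sumSq₃ w₁ w₂ w₃ ≡ sumSq₃ v₁ v₂ v₃ × Unit₃ (w₁ + w₂ + w₃)
  finish (w , e , unit) = w₁ , w₂ , w , cong₂ _+_ (cong₂ _+_ e₁ e₂) (trans e e₃) , unit

nine-sumSq₃-unit : ∀ {v₁} v₂ v₃ → Unit₃ v₁ → UnitSquares 3 (+ 9 * sumSq₃ v₁ v₂ v₃)
nine-sumSq₃-unit v₂ v₃ v₁-unit with w₁ , w₂ , w₃ , same , sum-unit ← unit-sum-by-signs v₂ v₃ v₁-unit =
  subst (λ S → UnitSquares 3 (+ 9 * S)) same (nine-sumSq₃-by-reflection w₁ w₂ w₃ sum-unit)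

size₃ : ℤ → ℤ → ℤ → ℕ
size₃ t₁ t₂ t₃ = ∣ t₁ ∣ ℕ.+ ∣ t₂ ∣ ℕ.+ ∣ t₃ ∣

nine-sumSq₃ : ∀ t₁ t₂ t₃ → 0 < size₃ t₁ t₂ t₃ → UnitSquares 3 (+ 9 * sumSq₃ t₁ t₂ t₃)
nine-sumSq₃ t₁ t₂ t₃ = <-rec P go (size₃ t₁ t₂ t₃) t₁ t₂ t₃ refl
  where
  P : ℕ → Set
  P s = ∀ t₁ t₂ t₃ → size₃ t₁ t₂ t₃ ≡ s → 0 < s → UnitSquares 3 (+ 9 * sumSq₃ t₁ t₂ t₃)
  go : ∀ s → (∀ {s′} → s′ < s → P s′) → P s
  go s rec t₁ t₂ t₃ size≡s 0<s with classify₃ t₁ | classify₃ t₂ | classify₃ t₃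
  ... | inj₂ t₁-unit | _ | _ = nine-sumSq₃-unit t₂ t₃ t₁-unit
  ... | inj₁ _ | inj₂ t₂-unit | _ =
    subst (λ S → UnitSquares 3 (+ 9 * S)) (swap t₂ t₁ t₃) (nine-sumSq₃-unit t₁ t₃ t₂-unit)
    where
    swap : ∀ a b c → a * a + b * b + c * c ≡ b * b + a * a + c * c
    swap = solve-∀
  ... | inj₁ _ | inj₁ _ | inj₂ t₃-unit =
    subst (λ S → UnitSquares 3 (+ 9 * S)) (rotate t₃ t₁ t₂) (nine-sumSq₃-unit t₁ t₂ t₃-unit)
    where
    rotate : ∀ a b c → a * a + b * b + c * c ≡ b * b + c * c + a * a
    rotate = solve-∀
  -- t = 3q: by recursion 9 Σ q² = Σ z² with all zᵢ prime to 3, and then 9 Σ t² = 9 Σ z².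
  ... | inj₁ (congruent q₁ refl) | inj₁ (congruent q₂ refl) | inj₁ (congruent q₃ refl)
    = scale-up (rec size-q<s q₁ q₂ q₃ refl 0<size-q)
    where
    ∣3q∣ : ∀ q → ∣ 0ℤ + + 3 * q ∣ ≡ 3 ℕ.* ∣ q ∣
    ∣3q∣ q = trans (cong ∣_∣ (ℤ.+-identityˡ (+ 3 * q))) (ℤ.abs-* (+ 3) q)
    distrib : ∀ a b c → 3 ℕ.* (a ℕ.+ b ℕ.+ c) ≡ 3 ℕ.* a ℕ.+ 3 ℕ.* b ℕ.+ 3 ℕ.* c
    distrib = ℕ-Solver.solve-∀
    3size-q≡s : 3 ℕ.* size₃ q₁ q₂ q₃ ≡ s
    3size-q≡s = trans (distrib (∣ q₁ ∣) (∣ q₂ ∣) (∣ q₃ ∣))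
      (trans (sym (cong₂ ℕ._+_ (cong₂ ℕ._+_ (∣3q∣ q₁) (∣3q∣ q₂)) (∣3q∣ q₃))) size≡s)
    0<size-q : 0 < size₃ q₁ q₂ q₃
    0<size-q = ℕ.n≢0⇒n>0 λ size-q≡0 → ℕ.<⇒≢ 0<s (trans (cong (3 ℕ.*_) (sym size-q≡0)) 3size-q≡s)
    size-q<s : size₃ q₁ q₂ q₃ < s
    size-q<s = subst (size₃ q₁ q₂ q₃ <_) (trans (ℕ.*-comm (size₃ q₁ q₂ q₃) 3) 3size-q≡s)
      (ℕ.m<m*n (size₃ q₁ q₂ q₃) 3 {{ℕ.>-nonZero 0<size-q}} (s≤s (s≤s z≤n)))
    regroup : ∀ a b c → a * a + b * b + c * c ≡ a * a + (b * b + (c * c + 0ℤ))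
    regroup = solve-∀
    scale : ∀ a b c → + 9 * (a * a + b * b + c * c) ≡
            (0ℤ + + 3 * a) * (0ℤ + + 3 * a) + (0ℤ + + 3 * b) * (0ℤ + + 3 * b) + (0ℤ + + 3 * c) * (0ℤ + + 3 * c)
    scale = solve-∀
    scale-up : UnitSquares 3 (+ 9 * sumSq₃ q₁ q₂ q₃) →
               UnitSquares 3 (+ 9 * sumSq₃ (0ℤ + + 3 * q₁) (0ℤ + + 3 * q₂) (0ℤ + + 3 * q₃))
    scale-up (z , z-units , 9Σq²≡Σz²) = subst (λ S → UnitSquares 3 (+ 9 * S))
      (trans (regroup (z zero) (z (suc zero)) (z (suc (suc zero)))) (trans (sym 9Σq²≡Σz²) (scale q₁ q₂ q₃)))
      (nine-sumSq₃-unit (z (suc zero)) (z (suc (suc zero))) (z-units zero))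

data OneOrFour : ℕ → Set where
  one  : OneOrFour 1
  four : OneOrFour 4

one-or-four : ∀ {k r} → r ≤ 4 → + suc (3 ℕ.* k) ≡ + r [mod 3 ] → OneOrFour r
one-or-four {k} {r} r≤4 n≡r = by-value r r≤4 (≡[mod]-trans (≡[mod]-sym n≡1) n≡r)
  where
  n≡1 : + suc (3 ℕ.* k) ≡ 1ℤ [mod 3 ]
  n≡1 = congruent (+ k) (trans (ℤ.pos-+ 1 (3 ℕ.* k)) (cong (_+_ 1ℤ) (ℤ.pos-* 3 k)))
  by-value : ∀ r → r ≤ 4 → 1ℤ ≡ + r [mod 3 ] → OneOrFour r
  by-value 0 _ 1≡0 = contradiction (≡[mod]⇒≡ (s≤s (s≤s z≤n)) (s≤s z≤n) 1≡0) λ ()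
  by-value 1 _ _ = one
  by-value 2 _ 1≡2 = contradiction (≡[mod]⇒≡ (s≤s (s≤s z≤n)) (s≤s (s≤s (s≤s z≤n))) 1≡2) λ ()
  by-value 3 _ 1≡3 =
    contradiction (≡[mod]⇒≡ {3} {1} {0} (s≤s (s≤s z≤n)) (s≤s z≤n) (≡[mod]-trans 1≡3 (congruent 1ℤ refl))) λ ()
  by-value 4 _ _ = four
  by-value (suc (suc (suc (suc (suc _))))) (s≤s (s≤s (s≤s (s≤s ())))) _

units≤1 : ∀ {x} (c : Class₃ x) → units c ≤ 1
units≤1 (inj₁ _) = z≤n
units≤1 (inj₂ _) = s≤s z≤n

sumSq₄-mod3 : ∀ {a b c d} (ca : Class₃ a) (cb : Class₃ b) (cc : Class₃ c) (cd : Class₃ d) →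
              sumSq₄ a b c d ≡ + (units ca ℕ.+ units cb ℕ.+ units cc ℕ.+ units cd) [mod 3 ]
sumSq₄-mod3 {a} {b} {c} {d} ca cb cc cd = subst (λ r → sumSq₄ a b c d ≡ r [mod 3 ]) (sym pos-sum)
  (≡[mod]-+ (≡[mod]-+ (≡[mod]-+ (square-mod3 ca) (square-mod3 cb)) (square-mod3 cc)) (square-mod3 cd))
  where
  pos-sum : + (units ca ℕ.+ units cb ℕ.+ units cc ℕ.+ units cd) ≡
            + units ca + + units cb + + units cc + + units cd
  pos-sum = trans (ℤ.pos-+ _ (units cd)) (cong (_+ + units cd)
              (trans (ℤ.pos-+ _ (units cc)) (cong (_+ + units cc) (ℤ.pos-+ (units ca) (units cb)))))

four-units : ∀ {n a b c d} → Unit₃ a → Unit₃ b → Unit₃ c → Unit₃ d → n ≡ sumSq₄ a b c d → UnitSquares 4 n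
four-units {a = a} {b} {c} {d} ua ub uc ud n≡Σ =
  subst (UnitSquares 4) (sym (trans n≡Σ (regroup a b c d)))
    (unitSquares-∷ ua (unitSquares-∷ ub (unitSquares-∷ uc (unitSquares-∷ ud unitSquares-[]))))
  where
  regroup : ∀ a b c d → a * a + b * b + c * c + d * d ≡ a * a + (b * b + (c * c + (d * d + 0ℤ)))
  regroup = solve-∀

one-unit : ∀ {n a b c d} → Unit₃ a → b ≡ 0ℤ [mod 3 ] → c ≡ 0ℤ [mod 3 ] → d ≡ 0ℤ [mod 3 ] →
           n ≡ sumSq₄ a b c d → UnitSquares 1 n ⊎ UnitSquares 4 n
one-unit {a = a} ua (congruent b refl) (congruent c refl) (congruent d refl) n≡Σ
  with size₃ b c d ℕ.≟ 0
... | no size≢0 = inj₂ (subst (UnitSquares 4) (sym (trans n≡Σ (split a b c d)))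
                    (unitSquares-∷ ua (nine-sumSq₃ b c d (ℕ.n≢0⇒n>0 size≢0))))
  where
  split : ∀ a b c d → a * a + (0ℤ + + 3 * b) * (0ℤ + + 3 * b) + (0ℤ + + 3 * c) * (0ℤ + + 3 * c) +
          (0ℤ + + 3 * d) * (0ℤ + + 3 * d) ≡ a * a + + 9 * (b * b + c * c + d * d)
  split = solve-∀
... | yes size≡0 = inj₁ (subst (UnitSquares 1) (sym (trans n≡Σ (vanish {b} {c} {d} b≡0 c≡0 d≡0)))
                          (unitSquares-∷ ua unitSquares-[]))
  where
  bc≡0 : ∣ b ∣ ℕ.+ ∣ c ∣ ≡ 0
  bc≡0 = ℕ.m+n≡0⇒m≡0 (∣ b ∣ ℕ.+ ∣ c ∣) size≡0
  b≡0 : b ≡ 0ℤ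
  b≡0 = ℤ.∣i∣≡0⇒i≡0 (ℕ.m+n≡0⇒m≡0 (∣ b ∣) bc≡0)
  c≡0 : c ≡ 0ℤ
  c≡0 = ℤ.∣i∣≡0⇒i≡0 (ℕ.m+n≡0⇒n≡0 (∣ b ∣) bc≡0)
  d≡0 : d ≡ 0ℤ
  d≡0 = ℤ.∣i∣≡0⇒i≡0 (ℕ.m+n≡0⇒n≡0 (∣ b ∣ ℕ.+ ∣ c ∣) size≡0)
  drop-zeros : ∀ x → x + 0ℤ + 0ℤ + 0ℤ ≡ x + 0ℤ
  drop-zeros = solve-∀
  vanish : ∀ {b c d} → b ≡ 0ℤ → c ≡ 0ℤ → d ≡ 0ℤ →
           sumSq₄ a (0ℤ + + 3 * b) (0ℤ + + 3 * c) (0ℤ + + 3 * d) ≡ a * a + 0ℤ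
  vanish refl refl refl = drop-zeros (a * a)

one-mod-three : ∀ k → UnitSquares 1 (+ suc (3 ℕ.* k)) ⊎ UnitSquares 4 (+ suc (3 ℕ.* k))
one-mod-three k = from-four-squares (lagrange (suc (3 ℕ.* k)))
  where
  n = + suc (3 ℕ.* k)
  from-four-squares : IsSumSq₄ n → UnitSquares 1 n ⊎ UnitSquares 4 n
  from-four-squares (a , b , c , d , n≡Σ) = by-classes (classify₃ a) (classify₃ b) (classify₃ c) (classify₃ d)
    where
    count : (ca : Class₃ a) (cb : Class₃ b) (cc : Class₃ c) (cd : Class₃ d) →
            OneOrFour (units ca ℕ.+ units cb ℕ.+ units cc ℕ.+ units cd)
    count ca cb cc cd = one-or-four {k}
      (ℕ.+-mono-≤ (ℕ.+-mono-≤ (ℕ.+-mono-≤ (units≤1 ca) (units≤1 cb)) (units≤1 cc)) (units≤1 cd))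
      (≡[mod]-trans (congruent 0ℤ (trans n≡Σ (sym (ℤ.+-identityʳ _)))) (sumSq₄-mod3 ca cb cc cd))
    swap : ∀ a b c d → a * a + b * b + c * c + d * d ≡ b * b + a * a + c * c + d * d
    swap = solve-∀
    rot₃ : ∀ a b c d → a * a + b * b + c * c + d * d ≡ c * c + a * a + b * b + d * d
    rot₃ = solve-∀
    rot₄ : ∀ a b c d → a * a + b * b + c * c + d * d ≡ d * d + a * a + b * b + c * c
    rot₄ = solve-∀
    by-count : (ca : Class₃ a) (cb : Class₃ b) (cc : Class₃ c) (cd : Class₃ d) →
               OneOrFour (units ca ℕ.+ units cb ℕ.+ units cc ℕ.+ units cd) → UnitSquares 1 n ⊎ UnitSquares 4 n
    by-count (inj₂ ua) (inj₂ ub) (inj₂ uc) (inj₂ ud) _ = inj₂ (four-units ua ub uc ud n≡Σ)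
    by-count (inj₂ ua) (inj₁ b≡0) (inj₁ c≡0) (inj₁ d≡0) _ = one-unit ua b≡0 c≡0 d≡0 n≡Σ
    by-count (inj₁ a≡0) (inj₂ ub) (inj₁ c≡0) (inj₁ d≡0) _ = one-unit ub a≡0 c≡0 d≡0 (trans n≡Σ (swap a b c d))
    by-count (inj₁ a≡0) (inj₁ b≡0) (inj₂ uc) (inj₁ d≡0) _ = one-unit uc a≡0 b≡0 d≡0 (trans n≡Σ (rot₃ a b c d))
    by-count (inj₁ a≡0) (inj₁ b≡0) (inj₁ c≡0) (inj₂ ud) _ = one-unit ud a≡0 b≡0 c≡0 (trans n≡Σ (rot₄ a b c d))
    by-count (inj₁ _) (inj₁ _) (inj₁ _) (inj₁ _) ()
    by-count (inj₁ _) (inj₂ _) (inj₁ _) (inj₂ _) ()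
    by-count (inj₂ _) (inj₁ _) (inj₁ _) (inj₂ _) ()
    by-count (inj₂ _) (inj₂ _) (inj₁ _) (inj₁ _) ()
    by-count (inj₂ _) (inj₁ _) (inj₂ _) (inj₁ _) ()
    by-count (inj₁ _) (inj₂ _) (inj₂ _) (inj₁ _) ()
    by-count (inj₁ _) (inj₁ _) (inj₂ _) (inj₂ _) ()
    by-count (inj₁ _) (inj₂ _) (inj₂ _) (inj₂ _) ()
    by-count (inj₂ _) (inj₁ _) (inj₂ _) (inj₂ _) ()
    by-count (inj₂ _) (inj₂ _) (inj₂ _) (inj₁ _) ()
    by-count (inj₂ _) (inj₂ _) (inj₁ _) (inj₂ _) ()
    by-classes : (ca : Class₃ a) (cb : Class₃ b) (cc : Class₃ c) (cd : Class₃ d) →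
                 UnitSquares 1 n ⊎ UnitSquares 4 n
    by-classes ca cb cc cd = by-count ca cb cc cd (count ca cb cc cd)

-- At most six squares

prime∤⇒gcd≡1 : ∀ {p n} → Prime p → ¬ p ∣ n → ℕ.gcd p n ≡ 1
prime∤⇒gcd≡1 {p} {n} p-prime p∤n with prime⇒irreducible p-prime (ℕ.gcd[m,n]∣m p n)
... | inj₁ gcd≡1 = gcd≡1
... | inj₂ gcd≡p = contradiction (subst (_∣ n) gcd≡p (ℕ.gcd[m,n]∣n p n)) p∤n

prime∤prodℤ : ∀ {p k} → Prime p → (x : Fin k → ℤ) → (∀ i → ¬ p ∣ ∣ x i ∣) → ¬ p ∣ ∣ prodℤ x ∣
prime∤prodℤ {k = zero}  p-prime x _   p∣1 = ¬prime[1] (subst Prime (∣1⇒≡1 p∣1) p-prime)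
prime∤prodℤ {k = suc k} p-prime x p∤x p∣∏
  with euclidsLemma ∣ x zero ∣ ∣ prodℤ (λ i → x (suc i)) ∣ p-prime (subst (_ ∣_) (ℤ.abs-* (x zero) _) p∣∏)
... | inj₁ p∣x₀ = p∤x zero p∣x₀
... | inj₂ p∣∏ = prime∤prodℤ p-prime (λ i → x (suc i)) (λ i → p∤x (suc i)) p∣∏

∣xᵢ∣∣∣∏x∣ : ∀ {k} (x : Fin k → ℤ) i → ∣ x i ∣ ∣ ∣ prodℤ x ∣
∣xᵢ∣∣∣∏x∣ {suc _} x i = subst (∣ x i ∣ ∣_) (sym (ℤ.abs-* (x zero) (prodℤ (λ j → x (suc j))))) (by-index i)
  where
  by-index : ∀ i → ∣ x i ∣ ∣ ∣ x zero ∣ ℕ.* ∣ prodℤ (λ j → x (suc j)) ∣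
  by-index zero    = m∣m*n _
  by-index (suc i) = ∣-trans (∣xᵢ∣∣∣∏x∣ (λ j → x (suc j)) i) (n∣m*n ∣ x zero ∣)

gcd≡1⇒∤ : ∀ {p k} → 1 < p → (x : Fin k → ℤ) → gcd (+ p) (prodℤ x) ≡ 1ℤ → ∀ i → ¬ p ∣ ∣ x i ∣
gcd≡1⇒∤ {p} 1<p x gcd≡1 i p∣xᵢ = ℕ.>⇒≢ 1<p (∣1⇒≡1 (subst (p ∣_) (ℤ.+-injective gcd≡1)
  (ℕ.gcd-greatest ∣-refl (∣-trans p∣xᵢ (∣xᵢ∣∣∣∏x∣ x i)))))

prime[3] : Prime 3
prime[3] = from-yes (prime? 3)

unitSquares⇒notDiv3 : ∀ {k n} → UnitSquares k (+ n) → SumOfSquaresNotDiv 3 k n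
unitSquares⇒notDiv3 (z , z-units , n≡Σz²) =
  z , n≡Σz² , cong +_ (prime∤⇒gcd≡1 prime[3] (prime∤prodℤ prime[3] z (λ i → unit⇒3∤ (z-units i))))

pad-ones : ∀ r {j n} → UnitSquares j (+ n) → UnitSquares (r ℕ.+ j) (+ (r ℕ.+ n))
pad-ones zero    s = s
pad-ones (suc r) {n = n} s =
  subst (UnitSquares _) (sym (ℤ.pos-+ 1 (r ℕ.+ n))) (unitSquares-∷ (inj₁ (congruent 0ℤ refl)) (pad-ones r s))

all-positive : AllPositiveSumOfAtMost 3 6
all-positive (suc n) _ =
  subst (SumOfAtMost 3 6) (sym 1+n≡r+[1+3k]) (add-ones (n ℕ.% 3) (m%n<n n 3) (one-mod-three k))
  where
  k = n ℕ./ 3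
  1+n≡r+[1+3k] : suc n ≡ n ℕ.% 3 ℕ.+ suc (3 ℕ.* k)
  1+n≡r+[1+3k] = trans (cong suc (trans (m≡m%n+[m/n]*n n 3) (cong (n ℕ.% 3 ℕ.+_) (ℕ.*-comm k 3))))
                       (sym (ℕ.+-suc (n ℕ.% 3) (3 ℕ.* k)))
  add-ones : ∀ r → r < 3 → UnitSquares 1 (+ suc (3 ℕ.* k)) ⊎ UnitSquares 4 (+ suc (3 ℕ.* k)) →
             SumOfAtMost 3 6 (r ℕ.+ suc (3 ℕ.* k))
  add-ones r r<3 (inj₁ s) = r ℕ.+ 1 , ℕ.+-mono-≤ (ℕ.s≤s⁻¹ r<3) (s≤s z≤n) , unitSquares⇒notDiv3 (pad-ones r s)
  add-ones r r<3 (inj₂ s) = r ℕ.+ 4 , ℕ.+-monoˡ-≤ 4 (ℕ.s≤s⁻¹ r<3)         , unitSquares⇒notDiv3 (pad-ones r s)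

-- Fifteen needs six squares

OnesFoursOrLarge : ℕ → ℕ → Set
OnesFoursOrLarge k S = 16 ≤ S ⊎ ∃[ e ] e ≤ k × S ≡ k ℕ.+ 3 ℕ.* e

-- The squares of numbers prime to 3 are 1 = 1 + 3·0, 4 = 1 + 3·1, and then at least 16.
add-square : ∀ {k S} a → ¬ 3 ∣ a → OnesFoursOrLarge k S → OnesFoursOrLarge (suc k) (a ℕ.* a ℕ.+ S)
add-square 0 3∤0 _ = contradiction (divides 0 refl) 3∤0
add-square {S = S} 1 _ (inj₁ 16≤S)          = inj₁ (ℕ.≤-trans 16≤S (ℕ.n≤1+n S))
add-square         1 _ (inj₂ (e , e≤k , S≡)) = inj₂ (e , ℕ.m≤n⇒m≤1+n e≤k , cong suc S≡)
add-square {S = S} 2 _ (inj₁ 16≤S)          = inj₁ (ℕ.≤-trans 16≤S (ℕ.m≤n+m S 4))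
add-square {k}     2 _ (inj₂ (e , e≤k , S≡)) = inj₂ (suc e , s≤s e≤k , trans (cong (4 ℕ.+_) S≡) (shift k e))
  where
  shift : ∀ k e → 4 ℕ.+ (k ℕ.+ 3 ℕ.* e) ≡ suc k ℕ.+ 3 ℕ.* suc e
  shift = ℕ-Solver.solve-∀
add-square 3 3∤3 _ = contradiction (divides 1 refl) 3∤3
add-square {S = S} a@(suc (suc (suc (suc _)))) _ _ =
  inj₁ (ℕ.≤-trans (ℕ.*-mono-≤ {4} {a} {4} {a} 4≤a 4≤a) (ℕ.m≤m+n (a ℕ.* a) S))
  where
  4≤a : 4 ≤ a
  4≤a = s≤s (s≤s (s≤s (s≤s z≤n)))

sum-of-squares-shape : ∀ {k} (x : Fin k → ℤ) → (∀ i → ¬ 3 ∣ ∣ x i ∣) →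
                       ∃[ S ] sumℤ (λ i → x i * x i) ≡ + S × OnesFoursOrLarge k S
sum-of-squares-shape {zero}  x _   = 0 , refl , inj₂ (0 , z≤n , refl)
sum-of-squares-shape {suc k} x 3∤x
  with S , Σ≡S , shape ← sum-of-squares-shape (λ i → x (suc i)) (λ i → 3∤x (suc i)) =
  ∣ x zero ∣ ℕ.* ∣ x zero ∣ ℕ.+ S , trans (cong₂ _+_ (square-abs (x zero)) Σ≡S) (sym (ℤ.pos-+ _ S)) ,
  add-square ∣ x zero ∣ (3∤x zero) shape

15≢k+3e : ∀ {k e} → k < 6 → e ≤ k → 15 ≢ k ℕ.+ 3 ℕ.* e
15≢k+3e k<6 e≤k = from-yes
  (ℕ.allUpTo? (λ k → ℕ.allUpTo? (λ e → e ℕ.≤? k →-dec ¬? (15 ℕ.≟ k ℕ.+ 3 ℕ.* e)) 6) 6)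
  k<6 (ℕ.≤-<-trans e≤k k<6) e≤k

fifteen-needs-six : ∀ {m} → m < 6 → ¬ SumOfSquaresNotDiv 3 m 15
fifteen-needs-six m<6 (x , 15≡Σ , gcd≡1)
  with S , Σ≡S , shape ← sum-of-squares-shape x (gcd≡1⇒∤ (s≤s (s≤s z≤n)) x gcd≡1)
  with ℤ.+-injective (trans 15≡Σ Σ≡S) | shape
... | refl | inj₁ 16≤15 = ℕ.<-irrefl refl 16≤15
... | refl | inj₂ (e , e≤m , 15≡m+3e) = 15≢k+3e m<6 e≤m 15≡m+3e

proposition2p4 : AllPositiveSumOfAtMost 3 6 × IsS 3 6
proposition2p4 = all-positive , all-positive , λ j j<6 at-most-j →
  let m , m≤j , rep = at-most-j 15 (s≤s z≤n) in fifteen-needs-six (ℕ.≤-<-trans m≤j j<6) rep
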